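{- Let $\mathcal{X}$ be an $n$-premaniplex, let $\mathcal{Y}_1$ be an $n$-premaniplex endowed with the mixing voltage $\mu$, and let $(\mathcal{Y}_2,\eta)$ be an $(n,m)$-voltage operator with $\mathcal{Y}_2$ connected. Suppose that for a vertex $y_2$ of $\mathcal{Y}_2$ the group $\eta(\Pi^{y_2}(\mathcal{Y}_2))$ fixes every vertex of $\mathcal{Y}_1$. Then $(\mathcal{X}\rtimes_\mu\mathcal{Y}_1)\rtimes_\eta\mathcal{Y}_2$ contains a copy of $\mathcal{X}\rtimes_\eta\mathcal{Y}_2$ for each vertex of $\mathcal{Y}_1$.
   Context: Graphs may have semiedges and parallel edges. A $k$-premaniplex is a graph whose darts are colored by $\{0,\dots,k-1\}$ (a dart and its inverse have the same color) such that every vertex is the starting point of exactly one dart of each color, and for $|i-j|\ge 2$ every path of length 4 alternating colors $i,j$ is closed. For a vertex $x$, ${}^i x$ denotes the dart of color $i$ starting at $x$, and $x^i$ its endpoint. The group $\mathrm{Mon}(\mathcal U^n)=\langle r_0,\dots,r_{n-1}\mid r_i^2=1,\ (r_ir_j)^2=1 \text{ for } |i-j|\ge2\rangle$ acts on the left on the vertex set of every $n$-premaniplex by $r_i x=x^i$. Paths are considered up to maniplex homotopy (inserting/deleting two consecutive darts of the same color, or swapping two consecutive colors $i,j$ with $|i-j|\ge2$); $\Pi^{y}(\mathcal Y)$ is the group of homotopy classes of closed paths based at $y$. A voltage assignment $\eta$ with group $G$ assigns $\eta(d)\in G$ to each dart $d$ with $\eta(d^{ -1})=\eta(d)^{ -1}$;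 the voltage of a path $d_1\cdots d_k$ is $\eta(d_k)\cdots\eta(d_1)$. An $(n,m)$-voltage operator is a pair $(\mathcal Y,\eta)$ with $\mathcal Y$ an $m$-premaniplex and $\eta$ a voltage assignment with group $\mathrm{Mon}(\mathcal U^n)$ such that every length-4 path alternating between colors $i,j$ with $|i-j|\ge2$ has trivial voltage. The mixing voltage $\mu$ on an $n$-premaniplex assigns $r_i$ to every dart of color $i$ (it makes the premaniplex an $(n,n)$-voltage operator). For an $n$-premaniplex $\mathcal X$, $\mathcal X\rtimes_\eta\mathcal Y$ is the $m$-premaniplex on $V(\mathcal X)\times V(\mathcal Y)$ where for each color $i$ there is an edge of color $i$ joining $(x,y)$ and $(\eta({}^i y)x,\ y^i)$. -}

module Defs where

open import Data.Nat using (ℕ; suc; _<_)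
open import Data.Fin using (Fin; toℕ)
open import Data.List using (List; []; _∷_; _++_; reverse)
open import Data.Sum using (_⊎_)
open import Data.Product using (Σ; _×_; _,_; proj₁; proj₂)
open import Relation.Binary.PropositionalEquality using (_≡_)

Far : {k : ℕ} → Fin k → Fin k → Set
Far i j = suc (toℕ i) < toℕ j ⊎ suc (toℕ j) < toℕ i

-- Mon(U^n) = ⟨ r_0..r_{n-1} | r_i² = 1, (r_i r_j)² = 1 for |i-j| ≥ 2 ⟩
-- Elements are words in the generators (the word  i₁ ∷ … ∷ i_k  stands
-- for r_{i₁} ⋯ r_{i_k}); equality in the group is the congruence _∼_
-- generated by the defining relations.

Word : ℕ → Set
Word n = List (Fin n)

infix 4 _∼_
data _∼_ {n : ℕ} : Word n → Word n → Set where
  ∼-refl   : ∀ {u} → u ∼ u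
  ∼-sym    : ∀ {u v} → u ∼ v → v ∼ u
  ∼-trans  : ∀ {u v w} → u ∼ v → v ∼ w → u ∼ w
  ∼-cancel : ∀ u v i → (u ++ i ∷ i ∷ v) ∼ (u ++ v)
  ∼-swap   : ∀ u v i j → Far i j → (u ++ i ∷ j ∷ v) ∼ (u ++ j ∷ i ∷ v)

_·_ : {n : ℕ} → Word n → Word n → Word n
u · v = u ++ v

inv : {n : ℕ} → Word n → Word n
inv = reverse

-- Colour graphs in which every vertex has exactly one dart of each
-- colour: the dart of colour i at x is identified with the pair (x , i),
-- its endpoint is  s i x  (= x^i), and its inverse dart is (s i x , i).
-- (A semiedge is a dart with s i x ≡ x.)

record ColGraph (k : ℕ) : Set₁ where
  field
    V : Set
    s : Fin k → V → V

open ColGraph public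

record Premaniplex (k : ℕ) : Set₁ where
  field
    graph : ColGraph k
    invol : ∀ i x → s graph i (s graph i x) ≡ x
    comm  : ∀ i j → Far i j → ∀ x →
            s graph j (s graph i (s graph j (s graph i x))) ≡ x

open Premaniplex public

act : {n : ℕ} (G : ColGraph n) → Word n → V G → V G
act G []      x = x
act G (i ∷ w) x = s G i (act G w x)

-- paths starting at a vertex, given by their sequence of colours
-- (the darts are determined by the start vertex and the colour)
pathEnd : {k : ℕ} (G : ColGraph k) → V G → List (Fin k) → V G
pathEnd G y []      = y
pathEnd G y (i ∷ p) = pathEnd G (s G i y) p

Connected : {k : ℕ} → ColGraph k → Set
Connected {k} G = ∀ y y' → Σ (List (Fin k)) (λ p → pathEnd G y p ≡ y')

-- voltage assignments with group Mon(U^n) on a colour graph with m colours: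
-- η y i is the voltage of the dart of colour i at y.

Voltage : (n : ℕ) {m : ℕ} → ColGraph m → Set
Voltage n {m} G = V G → Fin m → Word n

pathVolt : {n m : ℕ} (G : ColGraph m) → Voltage n G → V G → List (Fin m) → Word n
pathVolt G η y []      = []
pathVolt G η y (i ∷ p) = pathVolt G η (s G i y) p · η y i

record VoltageOperator (n m : ℕ) : Set₁ where
  field
    Y   : Premaniplex m
    η   : Voltage n (graph Y)
    η-inv : ∀ y i → η (s (graph Y) i y) i ∼ inv (η y i)
    η-comm : ∀ i j → Far i j → ∀ y →
             pathVolt (graph Y) η y (i ∷ j ∷ i ∷ j ∷ []) ∼ []

open VoltageOperator public

μ : {n : ℕ} (G : ColGraph n) → Voltage n G
μ G y i = i ∷ []

_⋊[_]_ : {n m : ℕ} (X : ColGraph n) (G : ColGraph m) → Voltage n G → ColGraph m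
V (X ⋊[ G ] η) = V X × V G
s (X ⋊[ G ] η) i (x , y) = act X (η y i) x , s G i y

-- an embedding of colour graphs (an injective colour-preserving map;
-- since darts are (vertex , colour) pairs it is injective on darts too)
record Embedding {k : ℕ} (A B : ColGraph k) : Set where
  field
    map      : V A → V B
    injective : ∀ a a' → map a ≡ map a' → a ≡ a'
    preserves : ∀ i a → map (s A i a) ≡ s B i (map a)

open Embedding public

-- Connectivity lets us pick, for every vertex y of Y₂, a path from y₂ to y.
-- Acting on a vertex y₁ of Y₁ by the voltage of that path gives a vertex
-- lift y₁ y; by hypothesis closed walks at y₂ act trivially on Y₁, so lift y₁ y
-- does not depend on the chosen path, and hence following a dart of colour i
-- at y changes lift y₁ y by the voltage of that dart. Since μ acts on
-- X ⋊_μ Y₁ coordinatewise, (x , y) ↦ ((x , lift y₁ y) , y) is then a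
-- colour-preserving injection of X ⋊_η Y₂, and different y₁ give disjoint
-- images because the voltage action on Y₁ is injective.
module Submission where

open import Defs
open import Data.Nat using (ℕ)
open import Data.List using (List; []; _∷_; _++_; reverse)
open import Data.List.Properties using (unfold-reverse)
open import Data.Fin using (Fin)
open import Data.Product using (Σ; _,_; proj₁; proj₂)
open import Relation.Binary.PropositionalEquality
open ≡-Reasoning

module _ {n : ℕ} (P : Premaniplex n) where
  private G = graph P

  act-++ : ∀ (u v : Word n) z → act G (u · v) z ≡ act G u (act G v z)
  act-++ []      v z = refl
  act-++ (i ∷ u) v z = cong (s G i) (act-++ u v z)

  act-inverse : ∀ (w : Word n) z → act G (inv w) (act G w z) ≡ z
  act-inverse []      z = refl
  act-inverse (i ∷ w) z rewrite unfold-reverse i w = begin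
    act G (inv w · (i ∷ [])) (s G i (act G w z)) ≡⟨ act-++ (inv w) (i ∷ []) _ ⟩
    act G (inv w) (s G i (s G i (act G w z)))     ≡⟨ cong (act G (inv w)) (invol P i (act G w z)) ⟩
    act G (inv w) (act G w z)                     ≡⟨ act-inverse w z ⟩
    z                                             ∎

  act-injective : ∀ (w : Word n) a b → act G w a ≡ act G w b → a ≡ b
  act-injective w a b e = begin
    a                         ≡⟨ sym (act-inverse w a) ⟩
    act G (inv w) (act G w a) ≡⟨ cong (act G (inv w)) e ⟩
    act G (inv w) (act G w b) ≡⟨ act-inverse w b ⟩
    b                         ∎

  s-swap : ∀ i j → Far i j → ∀ z → s G i (s G j z) ≡ s G j (s G i z)
  s-swap i j far z = begin
    s G i (s G j z)                                       ≡⟨ sym (comm P i j far _) ⟩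
    s G j (s G i (s G j (s G i (s G i (s G j z)))))       ≡⟨ cong (λ t → s G j (s G i (s G j t))) (invol P i (s G j z)) ⟩
    s G j (s G i (s G j (s G j z)))                       ≡⟨ cong (λ t → s G j (s G i t)) (invol P j z) ⟩
    s G j (s G i z)                                       ∎

  act-resp-∼ : ∀ {u v : Word n} → u ∼ v → ∀ z → act G u z ≡ act G v z
  act-resp-∼ ∼-refl          z = refl
  act-resp-∼ (∼-sym r)       z = sym (act-resp-∼ r z)
  act-resp-∼ (∼-trans r r′)  z = trans (act-resp-∼ r z) (act-resp-∼ r′ z)
  act-resp-∼ (∼-cancel u v i) z = begin
    act G (u · (i ∷ i ∷ v)) z             ≡⟨ act-++ u (i ∷ i ∷ v) z ⟩
    act G u (s G i (s G i (act G v z)))   ≡⟨ cong (act G u) (invol P i (act G v z)) ⟩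
    act G u (act G v z)                   ≡⟨ sym (act-++ u v z) ⟩
    act G (u · v) z                       ∎
  act-resp-∼ (∼-swap u v i j far) z = begin
    act G (u · (i ∷ j ∷ v)) z             ≡⟨ act-++ u (i ∷ j ∷ v) z ⟩
    act G u (s G i (s G j (act G v z)))   ≡⟨ cong (act G u) (s-swap i j far (act G v z)) ⟩
    act G u (s G j (s G i (act G v z)))   ≡⟨ sym (act-++ u (j ∷ i ∷ v) z) ⟩
    act G (u · (j ∷ i ∷ v)) z             ∎

act-⋊μ : ∀ {n} (X Z : ColGraph n) (w : Word n) x z →
  act (X ⋊[ Z ] μ Z) w (x , z) ≡ (act X w x , act Z w z)
act-⋊μ X Z []      x z = refl
act-⋊μ X Z (i ∷ w) x z rewrite act-⋊μ X Z w x z = refl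

pathEnd-++ : ∀ {k} (G : ColGraph k) y (p q : List (Fin k)) →
  pathEnd G y (p ++ q) ≡ pathEnd G (pathEnd G y p) q
pathEnd-++ G y []      q = refl
pathEnd-++ G y (i ∷ p) q = pathEnd-++ G (s G i y) p q

pathEnd-reverse : ∀ {k} (P : Premaniplex k) y (q : List (Fin k)) →
  pathEnd (graph P) (pathEnd (graph P) y q) (reverse q) ≡ y
pathEnd-reverse P y []      = refl
pathEnd-reverse P y (i ∷ q) rewrite unfold-reverse i q = begin
  pathEnd G (pathEnd G (s G i y) q) (reverse q ++ i ∷ [])     ≡⟨ pathEnd-++ G _ (reverse q) (i ∷ []) ⟩
  s G i (pathEnd G (pathEnd G (s G i y) q) (reverse q))       ≡⟨ cong (s G i) (pathEnd-reverse P (s G i y) q) ⟩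
  s G i (s G i y)                                             ≡⟨ invol P i y ⟩
  y                                                           ∎
  where G = graph P

module VoltageAction {n m : ℕ} (O : VoltageOperator n m) (Z : Premaniplex n) where
  private
    G = graph (Y O)
    H = graph Z

  voltAct : V G → List (Fin m) → V H → V H
  voltAct y p = act H (pathVolt G (η O) y p)

  voltAct-∷ : ∀ y i p z → voltAct y (i ∷ p) z ≡ voltAct (s G i y) p (act H (η O y i) z)
  voltAct-∷ y i p z = act-++ Z (pathVolt G (η O) (s G i y) p) (η O y i) z

  voltAct-++ : ∀ y (p q : List (Fin m)) z →
    voltAct y (p ++ q) z ≡ voltAct (pathEnd G y p) q (voltAct y p z)
  voltAct-++ y []      q z = refl
  voltAct-++ y (i ∷ p) q z = begin
    voltAct y (i ∷ p ++ q) z                                          ≡⟨ voltAct-∷ y i (p ++ q) z ⟩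
    voltAct (s G i y) (p ++ q) (act H (η O y i) z)                    ≡⟨ voltAct-++ (s G i y) p q _ ⟩
    voltAct (pathEnd G (s G i y) p) q (voltAct (s G i y) p (act H (η O y i) z))
                                                                      ≡⟨ cong (voltAct _ q) (sym (voltAct-∷ y i p z)) ⟩
    voltAct (pathEnd G (s G i y) p) q (voltAct y (i ∷ p) z)           ∎

  voltAct-reverse : ∀ y (q : List (Fin m)) z →
    voltAct (pathEnd G y q) (reverse q) (voltAct y q z) ≡ z
  voltAct-reverse y []      z = refl
  voltAct-reverse y (i ∷ q) z rewrite unfold-reverse i q = begin
    voltAct e (reverse q ++ i ∷ []) (voltAct y (i ∷ q) z)        ≡⟨ voltAct-++ e (reverse q) (i ∷ []) _ ⟩
    act H (η O (pathEnd G e (reverse q)) i) (voltAct e (reverse q) (voltAct y (i ∷ q) z))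
                                                                 ≡⟨ cong₂ (λ y′ t → act H (η O y′ i) t)
                                                                      (pathEnd-reverse (Y O) (s G i y) q)
                                                                      (cong (voltAct e (reverse q)) (voltAct-∷ y i q z)) ⟩
    act H (η O (s G i y) i) (voltAct e (reverse q) (voltAct (s G i y) q (act H (η O y i) z)))
                                                                 ≡⟨ cong (act H (η O (s G i y) i)) (voltAct-reverse (s G i y) q _) ⟩
    act H (η O (s G i y) i) (act H (η O y i) z)                  ≡⟨ act-resp-∼ Z (η-inv O y i) _ ⟩
    act H (inv (η O y i)) (act H (η O y i) z)                    ≡⟨ act-inverse Z (η O y i) z ⟩
    z                                                            ∎
    where e = pathEnd G (s G i y) q

  voltAct-injective : ∀ y p a b → voltAct y p a ≡ voltAct y p b → a ≡ b
  voltAct-injective y p = act-injective Z (pathVolt G (η O) y p)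

  -- A path p to y followed by q backwards is a closed walk at y₂.
  voltAct-path-independent : ∀ y₂ →
    (∀ p → pathEnd G y₂ p ≡ y₂ → ∀ z → voltAct y₂ p z ≡ z) →
    ∀ p q → pathEnd G y₂ p ≡ pathEnd G y₂ q → ∀ z → voltAct y₂ p z ≡ voltAct y₂ q z
  voltAct-path-independent y₂ closed-trivial p q same-end z =
    voltAct-injective (pathEnd G y₂ q) (reverse q) _ _ (begin
      voltAct (pathEnd G y₂ q) (reverse q) (voltAct y₂ p z)   ≡⟨ cong (λ y → voltAct y (reverse q) _) (sym same-end) ⟩
      voltAct (pathEnd G y₂ p) (reverse q) (voltAct y₂ p z)   ≡⟨ sym (voltAct-++ y₂ p (reverse q) z) ⟩
      voltAct y₂ (p ++ reverse q) z                           ≡⟨ closed-trivial (p ++ reverse q) closed z ⟩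
      z                                                       ≡⟨ sym (voltAct-reverse y₂ q z) ⟩
      voltAct (pathEnd G y₂ q) (reverse q) (voltAct y₂ q z)   ∎)
    where
    closed : pathEnd G y₂ (p ++ reverse q) ≡ y₂
    closed = begin
      pathEnd G y₂ (p ++ reverse q)                 ≡⟨ pathEnd-++ G y₂ p (reverse q) ⟩
      pathEnd G (pathEnd G y₂ p) (reverse q)        ≡⟨ cong (λ y → pathEnd G y (reverse q)) same-end ⟩
      pathEnd G (pathEnd G y₂ q) (reverse q)        ≡⟨ pathEnd-reverse (Y O) y₂ q ⟩
      y₂                                            ∎

module Copies {n m : ℕ} (X Y₁ : Premaniplex n) (O : VoltageOperator n m)
  (connected : Connected (graph (Y O))) (y₂ : V (graph (Y O)))
  (closed-trivial : ∀ p → pathEnd (graph (Y O)) y₂ p ≡ y₂ →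
                    ∀ y₁ → act (graph Y₁) (pathVolt (graph (Y O)) (η O) y₂ p) y₁ ≡ y₁)
  where
  open VoltageAction O Y₁
  private
    G = graph (Y O)
    H = graph Y₁

  pathTo : V G → List (Fin m)
  pathTo y = proj₁ (connected y₂ y)

  pathTo-end : ∀ y → pathEnd G y₂ (pathTo y) ≡ y
  pathTo-end y = proj₂ (connected y₂ y)

  lift : V H → V G → V H
  lift y₁ y = voltAct y₂ (pathTo y) y₁

  lift-step : ∀ y₁ i y → lift y₁ (s G i y) ≡ act H (η O y i) (lift y₁ y)
  lift-step y₁ i y = begin
    voltAct y₂ (pathTo (s G i y)) y₁                        ≡⟨ voltAct-path-independent y₂ closed-trivial (pathTo (s G i y)) (pathTo y ++ i ∷ []) same-end y₁ ⟩
    voltAct y₂ (pathTo y ++ i ∷ []) y₁                      ≡⟨ voltAct-++ y₂ (pathTo y) (i ∷ []) y₁ ⟩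
    act H (η O (pathEnd G y₂ (pathTo y)) i) (lift y₁ y)     ≡⟨ cong (λ y′ → act H (η O y′ i) (lift y₁ y)) (pathTo-end y) ⟩
    act H (η O y i) (lift y₁ y)                             ∎
    where
    same-end : pathEnd G y₂ (pathTo (s G i y)) ≡ pathEnd G y₂ (pathTo y ++ i ∷ [])
    same-end = begin
      pathEnd G y₂ (pathTo (s G i y))           ≡⟨ pathTo-end (s G i y) ⟩
      s G i y                                   ≡⟨ cong (s G i) (sym (pathTo-end y)) ⟩
      s G i (pathEnd G y₂ (pathTo y))           ≡⟨ sym (pathEnd-++ G y₂ (pathTo y) (i ∷ [])) ⟩
      pathEnd G y₂ (pathTo y ++ i ∷ [])         ∎

  copy : (y₁ : V H) →
    Embedding (graph X ⋊[ G ] η O) ((graph X ⋊[ H ] μ H) ⋊[ G ] η O)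
  map       (copy y₁) (x , y) = (x , lift y₁ y) , y
  injective (copy y₁) (x , y) (x′ , y′) e =
    cong₂ _,_ (cong (λ t → proj₁ (proj₁ t)) e) (cong proj₂ e)
  preserves (copy y₁) i (x , y) = cong (_, s G i y) (begin
    (act (graph X) (η O y i) x , lift y₁ (s G i y))                ≡⟨ cong (_ ,_) (lift-step y₁ i y) ⟩
    (act (graph X) (η O y i) x , act H (η O y i) (lift y₁ y))      ≡⟨ sym (act-⋊μ (graph X) H (η O y i) x (lift y₁ y)) ⟩
    act (graph X ⋊[ H ] μ H) (η O y i) (x , lift y₁ y)             ∎)

  copies-disjoint : ∀ y₁ y₁′ a a′ → map (copy y₁) a ≡ map (copy y₁′) a′ → y₁ ≡ y₁′
  copies-disjoint y₁ y₁′ (x , y) (x′ , y′) e with cong proj₂ e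
  ... | refl = voltAct-injective y₂ (pathTo y) y₁ y₁′ (cong (λ t → proj₂ (proj₁ t)) e)

corollary6p3 : {n m : ℕ} (X Y₁ : Premaniplex n) (O : VoltageOperator n m) →
    Connected (graph (Y O)) →
    (y₂ : V (graph (Y O))) →
    (∀ (p : List (Fin m)) → pathEnd (graph (Y O)) y₂ p ≡ y₂ →
      ∀ (y₁ : V (graph Y₁)) →
        act (graph Y₁) (pathVolt (graph (Y O)) (η O) y₂ p) y₁ ≡ y₁) →
    Σ ((y₁ : V (graph Y₁)) →
         Embedding (graph X ⋊[ graph (Y O) ] η O)
                   ((graph X ⋊[ graph Y₁ ] μ (graph Y₁)) ⋊[ graph (Y O) ] η O))
      (λ f → ∀ y₁ y₁' a a' → map (f y₁) a ≡ map (f y₁') a' → y₁ ≡ y₁')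
corollary6p3 X Y₁ O connected y₂ closed-trivial = copy , copies-disjoint
  where open Copies X Y₁ O connected y₂ closed-trivial
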